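{- If $G$ is a prime bipartite graph, then $G*v\setminus v$ is prime for every vertex $v$ of $G$.
   Context: Graphs are finite and simple. $G*v$ is the graph on $V(G)$ with $E(G*v)=E(G)\triangle\{xy:x,y\text{ distinct neighbors of }v\}$. A split of a graph is a partition $(A,B)$ of its vertex set with $\min\{|A|,|B|\}\ge2$ such that for some $A'\subseteq A$, $B'\subseteq B$, vertices $x\in A$, $y\in B$ are adjacent iff $x\in A'$ and $y\in B'$; a graph is prime if it has no split. -}

module Defs where

open import Data.Nat using (ℕ; suc)
open import Data.Fin using (Fin; punchIn; _≟_)
open import Data.Fin.Properties using (punchIn-injective)
open import Data.Bool using (Bool; true; false; _xor_; _∧_; not)
open import Data.Product using (Σ; ∃; _×_; _,_)
open import Relation.Nullary using (¬_; yes; no)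
open import Relation.Nullary.Decidable using (⌊_⌋)
open import Relation.Binary.PropositionalEquality using (_≡_; _≢_; refl; cong₂; sym)

record Graph (n : ℕ) : Set where
  field
    adj    : Fin n → Fin n → Bool
    adjSym : ∀ x y → adj x y ≡ adj y x
    adjIrr : ∀ x → adj x x ≡ false
open Graph public

distinct : ∀ {n} → Fin n → Fin n → Bool
distinct x y = not ⌊ x ≟ y ⌋

private
  distinct-sym : ∀ {n} (x y : Fin n) → distinct x y ≡ distinct y x
  distinct-sym x y with x ≟ y | y ≟ x
  ... | yes _ | yes _ = refl
  ... | no _  | no _  = refl
  ... | yes p | no q = Data.Empty.⊥-elim (q (sym p))
    where import Data.Empty
  ... | no p  | yes q = Data.Empty.⊥-elim (p (sym q))
    where import Data.Empty

  distinct-refl : ∀ {n} (x : Fin n) → distinct x x ≡ false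
  distinct-refl x with x ≟ x
  ... | yes _ = refl
  ... | no p  = Data.Empty.⊥-elim (p refl)
    where import Data.Empty

  ∧-comm : ∀ a b → a ∧ b ≡ b ∧ a
  ∧-comm true true = refl
  ∧-comm true false = refl
  ∧-comm false true = refl
  ∧-comm false false = refl

  lcAdj : ∀ {n} → Graph n → Fin n → Fin n → Fin n → Bool
  lcAdj G v x y = adj G x y xor (distinct x y ∧ (adj G v x ∧ adj G v y))

  lcSym : ∀ {n} (G : Graph n) v x y → lcAdj G v x y ≡ lcAdj G v y x
  lcSym G v x y rewrite adjSym G x y | distinct-sym x y | ∧-comm (adj G v x) (adj G v y) = refl

  lcIrr : ∀ {n} (G : Graph n) v x → lcAdj G v x x ≡ false
  lcIrr G v x rewrite adjIrr G x | distinct-refl x = refl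

_*_ : ∀ {n} → Graph n → Fin n → Graph n
G * v = record { adj = lcAdj G v ; adjSym = lcSym G v ; adjIrr = lcIrr G v }

_∖_ : ∀ {m} → Graph (suc m) → Fin (suc m) → Graph m
G ∖ v = record
  { adj    = λ x y → adj G (punchIn v x) (punchIn v y)
  ; adjSym = λ x y → adjSym G (punchIn v x) (punchIn v y)
  ; adjIrr = λ x → adjIrr G (punchIn v x)
  }

-- A split: partition (A, B) of V(G), A given by its indicator (B = complement),
-- with |A| ≥ 2, |B| ≥ 2, and A' ⊆ A, B' ⊆ B such that for x ∈ A, y ∈ B,
-- x ~ y iff x ∈ A' and y ∈ B'.
record Split {n : ℕ} (G : Graph n) : Set where
  field
    inA      : Fin n → Bool
    a₁ a₂    : Fin n
    a₁≢a₂    : a₁ ≢ a₂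
    a₁∈A     : inA a₁ ≡ true
    a₂∈A     : inA a₂ ≡ true
    b₁ b₂    : Fin n
    b₁≢b₂    : b₁ ≢ b₂
    b₁∈B     : inA b₁ ≡ false
    b₂∈B     : inA b₂ ≡ false
    inA'     : Fin n → Bool
    inB'     : Fin n → Bool
    A'⊆A     : ∀ x → inA' x ≡ true → inA x ≡ true
    B'⊆B     : ∀ y → inB' y ≡ true → inA y ≡ false
    adj⇒A'B' : ∀ x y → inA x ≡ true → inA y ≡ false →
               adj G x y ≡ true → (inA' x ≡ true × inB' y ≡ true)
    A'B'⇒adj : ∀ x y → inA x ≡ true → inA y ≡ false →
               (inA' x ≡ true × inB' y ≡ true) → adj G x y ≡ true

Prime : ∀ {n} → Graph n → Set
Prime G = ¬ Split G

Bipartite : ∀ {n} → Graph n → Set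
Bipartite {n} G = Σ (Fin n → Bool) λ c → ∀ x y → adj G x y ≡ true → c x ≢ c y

-- Let (A, B) be a split of H = (G * v) ∖ v. If the neighbourhood N of v meets B in ∅ or in
-- all of B', then v can be added to A, giving a split of G * v, hence of G (local
-- complementation preserves splits). By symmetry, if G is prime we find y₁ ∈ B ∩ N,
-- y₂ ∈ B with y₂ ∈ N ⇎ y₂ ∈ B', and likewise x₁, x₂ ∈ A. As G is bipartite, N is
-- independent in G; since G and H differ across (A, B) exactly on N × N, this forces
-- x₁ ∈ A', y₁ ∈ B', then x₂ ∈ A' ∖ N and y₂ ∈ B' ∖ N. Then v x₁ y₂ x₂ y₁ is a 5-cycle in G.
module Submission where

open import Data.Nat using (ℕ; suc)
open import Data.Fin using (Fin; punchIn; punchOut; _≟_)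
open import Data.Fin.Properties using (punchIn-injective; punchInᵢ≢i; punchIn-punchOut; any?)
open import Data.Bool using (Bool; true; false; _xor_; _∧_; not)
open import Data.Bool.Properties using
  (∧-assoc; ∧-comm; ∧-zeroʳ; ∧-conicalˡ; ∧-conicalʳ; ∧-distribʳ-xor; xor-assoc; xor-same;
   xor-identityʳ; xor-comm; not-involutive; not-injective; not-¬; ¬-not)
  renaming (_≟_ to _≟ᵇ_)
open import Data.Vec.Functional using (insertAt)
open import Data.Vec.Functional.Properties using (insertAt-lookup; insertAt-punchIn)
open import Data.Product using (∃-syntax; _×_; _,_; proj₁; proj₂)
open import Data.Empty using (⊥; ⊥-elim)
open import Function using (_∘_)
open import Relation.Nullary using (¬_; yes; no)
open import Relation.Nullary.Decidable using (¬?; _×-dec_; decidable-stable)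
open import Relation.Binary.PropositionalEquality
open import Defs

implies-but-differs : ∀ {a b} → (a ≡ true → b ≡ true) → a ≢ b → a ≡ false × b ≡ true
implies-but-differs {true}  a⇒b a≢b = ⊥-elim (a≢b (sym (a⇒b refl)))
implies-but-differs {false} a⇒b a≢b = refl , ¬-not (a≢b ∘ sym)

xor-cancelʳ : ∀ a b → (a xor b) xor b ≡ a
xor-cancelʳ a b = trans (xor-assoc a b b) (trans (cong (a xor_) (xor-same b)) (xor-identityʳ a))

distinct-≢ : ∀ {n} {x y : Fin n} → x ≢ y → distinct x y ≡ true
distinct-≢ {x = x} {y} x≢y with x ≟ y
... | yes x≡y = ⊥-elim (x≢y x≡y)
... | no _    = refl

data PunchInView {m} (v : Fin (suc m)) : Fin (suc m) → Set where
  at-v    : PunchInView v v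
  punched : (x : Fin m) → PunchInView v (punchIn v x)

punchIn-view : ∀ {m} (v w : Fin (suc m)) → PunchInView v w
punchIn-view v w with v ≟ w
... | yes refl = at-v
... | no v≢w   = subst (PunchInView v) (punchIn-punchOut v≢w) (punched (punchOut v≢w))

module _ {n} {G : Graph n} {inA inA' inB' : Fin n → Bool}
         (cross : ∀ x y → inA x ≡ true → inA y ≡ false → adj G x y ≡ inA' x ∧ inB' y) where

  crossing⇒ : ∀ x y → inA x ≡ true → inA y ≡ false →
              adj G x y ≡ true → inA' x ≡ true × inB' y ≡ true
  crossing⇒ x y x∈A y∈B x~y = ∧-conicalˡ _ _ eq , ∧-conicalʳ _ _ eq
    where
    eq : inA' x ∧ inB' y ≡ true
    eq = trans (sym (cross x y x∈A y∈B)) x~y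

  crossing⇐ : ∀ x y → inA x ≡ true → inA y ≡ false →
              inA' x ≡ true × inB' y ≡ true → adj G x y ≡ true
  crossing⇐ x y x∈A y∈B (x∈A' , y∈B') = trans (cross x y x∈A y∈B) (cong₂ _∧_ x∈A' y∈B')

module _ {n} {G : Graph n} (S : Split G) where
  open Split S

  crossing : ∀ x y → inA x ≡ true → inA y ≡ false → adj G x y ≡ inA' x ∧ inB' y
  crossing x y x∈A y∈B with adj G x y in x~y | inA' x in x∈A' | inB' y in y∈B'
  ... | true  | _     | _     = sym (cong₂ _∧_ (trans (sym x∈A') (proj₁ adjacent))
                                             (trans (sym y∈B') (proj₂ adjacent)))
    where
    adjacent : inA' x ≡ true × inB' y ≡ true
    adjacent = adj⇒A'B' x y x∈A y∈B x~y
  ... | false | true  | true  = trans (sym x~y) (A'B'⇒adj x y x∈A y∈B (x∈A' , y∈B'))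
  ... | false | true  | false = refl
  ... | false | false | _     = refl

  A-≢-B : ∀ {x y} → inA x ≡ true → inA y ≡ false → x ≢ y
  A-≢-B x∈A y∈B refl with () ← trans (sym x∈A) y∈B

  swap : Split G
  swap = record
    { inA = not ∘ inA
    ; a₁ = b₁ ; a₂ = b₂ ; a₁≢a₂ = b₁≢b₂ ; a₁∈A = cong not b₁∈B ; a₂∈A = cong not b₂∈B
    ; b₁ = a₁ ; b₂ = a₂ ; b₁≢b₂ = a₁≢a₂ ; b₁∈B = cong not a₁∈A ; b₂∈B = cong not a₂∈A
    ; inA' = inB' ; inB' = inA'
    ; A'⊆A = λ y y∈B' → cong not (B'⊆B y y∈B')
    ; B'⊆B = λ x x∈A' → cong not (A'⊆A x x∈A')
    ; adj⇒A'B' = crossing⇒ {G = G} swapped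
    ; A'B'⇒adj = crossing⇐ {G = G} swapped
    }
    where
    swapped : ∀ y x → not (inA y) ≡ true → not (inA x) ≡ false → adj G y x ≡ inB' y ∧ inA' x
    swapped y x y∈B x∈A = begin
      adj G y x          ≡⟨ adjSym G y x ⟩
      adj G x y          ≡⟨ crossing x y (not-injective x∈A) (not-injective y∈B) ⟩
      inA' x ∧ inB' y    ≡⟨ ∧-comm (inA' x) (inB' y) ⟩
      inB' y ∧ inA' x    ∎
      where open ≡-Reasoning

*-adj-centre : ∀ {n} (G : Graph n) v x → adj (G * v) v x ≡ adj G v x
*-adj-centre G v x rewrite adjIrr G v | ∧-zeroʳ (distinct v x) = xor-identityʳ (adj G v x)

private
  module _ {n} {G : Graph n} {v : Fin n} (S : Split (G * v)) where
    open Split S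

    -- Local complementation at v toggles the edges across (A, B) between N ∩ A and N ∩ B,
    -- and N ∩ B is B' or ∅ according as v ∈ A' or not; so only A' has to change.
    reflect-from-A : inA v ≡ true → Split G
    reflect-from-A v∈A = record
      { inA = inA ; a₁ = a₁ ; a₂ = a₂ ; a₁≢a₂ = a₁≢a₂ ; a₁∈A = a₁∈A ; a₂∈A = a₂∈A
      ; b₁ = b₁ ; b₂ = b₂ ; b₁≢b₂ = b₁≢b₂ ; b₁∈B = b₁∈B ; b₂∈B = b₂∈B
      ; inA' = A'' ; inB' = inB'
      ; A'⊆A = λ x x∈A'' → ∧-conicalˡ (inA x) _ x∈A''
      ; B'⊆B = B'⊆B
      ; adj⇒A'B' = crossing⇒ {G = G} cross ; A'B'⇒adj = crossing⇐ {G = G} cross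
      }
      where
      N : Fin n → Bool
      N = adj G v

      c : Bool
      c = inA' v

      A'' : Fin n → Bool
      A'' x = inA x ∧ (inA' x xor (N x ∧ c))

      N-on-B : ∀ y → inA y ≡ false → N y ≡ c ∧ inB' y
      N-on-B y y∈B = trans (sym (*-adj-centre G v y)) (crossing S v y v∈A y∈B)

      cross : ∀ x y → inA x ≡ true → inA y ≡ false → adj G x y ≡ A'' x ∧ inB' y
      cross x y x∈A y∈B = begin
        adj G x y
          ≡⟨ sym (xor-cancelʳ (adj G x y) (distinct x y ∧ (N x ∧ N y))) ⟩
        adj (G * v) x y xor (distinct x y ∧ (N x ∧ N y))
          ≡⟨ cong₂ (λ e d → e xor (d ∧ (N x ∧ N y))) (crossing S x y x∈A y∈B)
                   (distinct-≢ (A-≢-B S x∈A y∈B)) ⟩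
        (inA' x ∧ inB' y) xor (N x ∧ N y)
          ≡⟨ cong (λ k → (inA' x ∧ inB' y) xor (N x ∧ k)) (N-on-B y y∈B) ⟩
        (inA' x ∧ inB' y) xor (N x ∧ (c ∧ inB' y))
          ≡⟨ cong ((inA' x ∧ inB' y) xor_) (sym (∧-assoc (N x) c (inB' y))) ⟩
        (inA' x ∧ inB' y) xor ((N x ∧ c) ∧ inB' y)
          ≡⟨ sym (∧-distribʳ-xor (inB' y) (inA' x) (N x ∧ c)) ⟩
        (inA' x xor (N x ∧ c)) ∧ inB' y
          ≡⟨ cong (λ a → (a ∧ (inA' x xor (N x ∧ c))) ∧ inB' y) (sym x∈A) ⟩
        A'' x ∧ inB' y
          ∎
        where open ≡-Reasoning

*-reflects-Split : ∀ {n} {G : Graph n} {v} → Split (G * v) → Split G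
*-reflects-Split {v = v} S with Split.inA S v in v∈A
... | true  = reflect-from-A S v∈A
... | false = reflect-from-A (swap S) (cong not v∈A)

module _ {m} (G : Graph (suc m)) (v : Fin (suc m)) (S : Split (G ∖ v)) where
  open Split S

  -- v can be added to side A, belonging to A' exactly when c holds
  CanJoinA : Bool → Set
  CanJoinA c = ∀ y → inA y ≡ false → adj G v (punchIn v y) ≡ c ∧ inB' y

  join-A : ∀ {c} → CanJoinA c → Split G
  join-A {c} joins = record
    { inA = inA⁺
    ; a₁ = v ; a₂ = punchIn v a₁ ; a₁≢a₂ = punchInᵢ≢i v a₁ ∘ sym
    ; a₁∈A = insertAt-lookup inA v true
    ; a₂∈A = trans (insertAt-punchIn inA v true a₁) a₁∈A
    ; b₁ = punchIn v b₁ ; b₂ = punchIn v b₂ ; b₁≢b₂ = b₁≢b₂ ∘ punchIn-injective v b₁ b₂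
    ; b₁∈B = trans (insertAt-punchIn inA v true b₁) b₁∈B
    ; b₂∈B = trans (insertAt-punchIn inA v true b₂) b₂∈B
    ; inA' = insertAt inA' v c ; inB' = insertAt inB' v false
    ; A'⊆A = A'⊆A⁺ ; B'⊆B = B'⊆B⁺
    ; adj⇒A'B' = crossing⇒ {G = G} cross ; A'B'⇒adj = crossing⇐ {G = G} cross
    }
    where
    inA⁺ : Fin (suc m) → Bool
    inA⁺ = insertAt inA v true

    A'⊆A⁺ : ∀ w → insertAt inA' v c w ≡ true → inA⁺ w ≡ true
    A'⊆A⁺ w w∈A' with punchIn-view v w
    ... | at-v      = insertAt-lookup inA v true
    ... | punched x = trans (insertAt-punchIn inA v true x)
                            (A'⊆A x (trans (sym (insertAt-punchIn inA' v c x)) w∈A'))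

    B'⊆B⁺ : ∀ w → insertAt inB' v false w ≡ true → inA⁺ w ≡ false
    B'⊆B⁺ w w∈B' with punchIn-view v w
    ... | at-v      with () ← trans (sym (insertAt-lookup inB' v false)) w∈B'
    ... | punched y = trans (insertAt-punchIn inA v true y)
                            (B'⊆B y (trans (sym (insertAt-punchIn inB' v false y)) w∈B'))

    cross : ∀ w z → inA⁺ w ≡ true → inA⁺ z ≡ false →
            adj G w z ≡ insertAt inA' v c w ∧ insertAt inB' v false z
    cross w z w∈A z∈B with punchIn-view v z
    ... | at-v with () ← trans (sym (insertAt-lookup inA v true)) z∈B
    ... | punched y
      rewrite insertAt-punchIn inB' v false y with punchIn-view v w
    ...   | at-v      rewrite insertAt-lookup inA' v c =
              joins y (trans (sym (insertAt-punchIn inA v true y)) z∈B)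
    ...   | punched x rewrite insertAt-punchIn inA' v c x =
              crossing S x y (trans (sym (insertAt-punchIn inA v true x)) w∈A)
                             (trans (sym (insertAt-punchIn inA v true y)) z∈B)

  cannot-join-witness : ∀ {c} → ¬ CanJoinA c →
                        ∃[ y ] inA y ≡ false × adj G v (punchIn v y) ≢ c ∧ inB' y
  cannot-join-witness {c} ¬joins
    with any? (λ y → (inA y ≟ᵇ false) ×-dec ¬? (adj G v (punchIn v y) ≟ᵇ c ∧ inB' y))
  ... | yes witness = witness
  ... | no ¬witness = ⊥-elim (¬joins λ y y∈B →
          decidable-stable (adj G v (punchIn v y) ≟ᵇ c ∧ inB' y) λ ne → ¬witness (y , y∈B , ne))

module BipartiteProperties {n} {G : Graph n} (bip : Bipartite G) where
  private
    colour : Fin n → Bool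
    colour = proj₁ bip

  colour-flips : ∀ {x y} → adj G x y ≡ true → colour y ≡ not (colour x)
  colour-flips {x} {y} x~y = ¬-not (proj₂ bip x y x~y ∘ sym)

  common-neighbours-nonadjacent : ∀ {v x y} → adj G v x ≡ true → adj G v y ≡ true →
                                  adj G x y ≡ false
  common-neighbours-nonadjacent {x = x} {y} v~x v~y =
    ¬-not λ x~y → proj₂ bip x y x~y (trans (colour-flips v~x) (sym (colour-flips v~y)))

  no-5-cycle : ∀ {a b c d e} → adj G a b ≡ true → adj G b c ≡ true → adj G c d ≡ true →
               adj G d e ≡ true → adj G e a ≡ true → ⊥
  no-5-cycle {a} {b} {c} {d} {e} a~b b~c c~d d~e e~a = not-¬ refl (begin
    colour a                   ≡⟨ colour-flips e~a ⟩
    not (colour e)             ≡⟨ cong not (colour-flips d~e) ⟩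
    not (not (colour d))       ≡⟨ not-involutive (colour d) ⟩
    colour d                   ≡⟨ colour-flips c~d ⟩
    not (colour c)             ≡⟨ cong not (colour-flips b~c) ⟩
    not (not (colour b))       ≡⟨ not-involutive (colour b) ⟩
    colour b                   ≡⟨ colour-flips a~b ⟩
    not (colour a)             ∎)
    where open ≡-Reasoning

module _ {m} (G : Graph (suc m)) (v : Fin (suc m)) (bip : Bipartite G)
         (S : Split ((G * v) ∖ v)) where
  open Split S
  open BipartiteProperties {G = G} bip

  private
    N : Fin m → Bool
    N y = adj G v (punchIn v y)

    adj-across : ∀ {x y} → inA x ≡ true → inA y ≡ false →
                 adj G (punchIn v x) (punchIn v y) ≡ (inA' x ∧ inB' y) xor (N x ∧ N y)
    adj-across {x} {y} x∈A y∈B = begin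
      adj G (punchIn v x) (punchIn v y)
        ≡⟨ sym (xor-cancelʳ _ (N x ∧ N y)) ⟩
      (adj G (punchIn v x) (punchIn v y) xor (N x ∧ N y)) xor (N x ∧ N y)
        ≡⟨ cong (λ d → (adj G (punchIn v x) (punchIn v y) xor (d ∧ (N x ∧ N y))) xor (N x ∧ N y))
                (sym (distinct-≢ (A-≢-B S x∈A y∈B ∘ punchIn-injective v x y))) ⟩
      adj ((G * v) ∖ v) x y xor (N x ∧ N y)
        ≡⟨ cong (_xor (N x ∧ N y)) (crossing S x y x∈A y∈B) ⟩
      (inA' x ∧ inB' y) xor (N x ∧ N y)
        ∎
      where open ≡-Reasoning

    neighbours-across : ∀ {x y} → inA x ≡ true → inA y ≡ false → N x ≡ true → N y ≡ true →
                        inA' x ≡ true × inB' y ≡ true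
    neighbours-across {x} {y} x∈A y∈B v~x v~y = ∧-conicalˡ _ _ both , ∧-conicalʳ _ _ both
      where
      both : inA' x ∧ inB' y ≡ true
      both = not-injective (begin
        not (inA' x ∧ inB' y)               ≡⟨ xor-comm true (inA' x ∧ inB' y) ⟩
        (inA' x ∧ inB' y) xor true          ≡⟨ cong ((inA' x ∧ inB' y) xor_) (cong₂ _∧_ v~x v~y) ⟨
        (inA' x ∧ inB' y) xor (N x ∧ N y)   ≡⟨ sym (adj-across x∈A y∈B) ⟩
        adj G (punchIn v x) (punchIn v y)   ≡⟨ common-neighbours-nonadjacent v~x v~y ⟩
        false                               ∎)
        where open ≡-Reasoning

    edge-across : ∀ {x y} → inA x ≡ true → inA y ≡ false → inA' x ≡ true → inB' y ≡ true →
                  N x ∧ N y ≡ false → adj G (punchIn v x) (punchIn v y) ≡ true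
    edge-across x∈A y∈B x∈A' y∈B' non-common =
      trans (adj-across x∈A y∈B) (cong₂ _xor_ (cong₂ _∧_ x∈A' y∈B') non-common)

    five-cycle : ∀ {x₁ x₂ y₁ y₂} → inA x₁ ≡ true → inA x₂ ≡ true → inA y₁ ≡ false → inA y₂ ≡ false →
                 N x₁ ≡ true → N y₁ ≡ true → N x₂ ≢ inA' x₂ → N y₂ ≢ inB' y₂ → ⊥
    five-cycle {x₁} {x₂} {y₁} {y₂} x₁∈A x₂∈A y₁∈B y₂∈B v~x₁ v~y₁ Nx₂≢A' Ny₂≢B' =
      no-5-cycle v~x₁ x₁~y₂ (trans (adjSym G _ _) x₂~y₂) x₂~y₁ (trans (adjSym G _ _) v~y₁)
      where
      inside : inA' x₁ ≡ true × inB' y₁ ≡ true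
      inside = neighbours-across x₁∈A y₁∈B v~x₁ v~y₁

      x₂-outside : N x₂ ≡ false × inA' x₂ ≡ true
      x₂-outside = implies-but-differs
        (λ v~x₂ → proj₁ (neighbours-across x₂∈A y₁∈B v~x₂ v~y₁)) Nx₂≢A'

      y₂-outside : N y₂ ≡ false × inB' y₂ ≡ true
      y₂-outside = implies-but-differs
        (λ v~y₂ → proj₂ (neighbours-across x₁∈A y₂∈B v~x₁ v~y₂)) Ny₂≢B'

      x₁~y₂ : adj G (punchIn v x₁) (punchIn v y₂) ≡ true
      x₁~y₂ = edge-across x₁∈A y₂∈B (proj₁ inside) (proj₂ y₂-outside)
                (trans (cong (N x₁ ∧_) (proj₁ y₂-outside)) (∧-zeroʳ (N x₁)))

      x₂~y₂ : adj G (punchIn v x₂) (punchIn v y₂) ≡ true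
      x₂~y₂ = edge-across x₂∈A y₂∈B (proj₂ x₂-outside) (proj₂ y₂-outside)
                (cong (_∧ N y₂) (proj₁ x₂-outside))

      x₂~y₁ : adj G (punchIn v x₂) (punchIn v y₁) ≡ true
      x₂~y₁ = edge-across x₂∈A y₁∈B (proj₂ x₂-outside) (proj₂ inside)
                (cong (_∧ N y₁) (proj₁ x₂-outside))

  v-joins-a-side : ¬ CanJoinA (G * v) v S false → ¬ CanJoinA (G * v) v S true →
                   ¬ CanJoinA (G * v) v (swap S) false → ¬ CanJoinA (G * v) v (swap S) true → ⊥
  v-joins-a-side ¬B₀ ¬B₁ ¬A₀ ¬A₁
    with cannot-join-witness (G * v) v S ¬B₀ | cannot-join-witness (G * v) v S ¬B₁
       | cannot-join-witness (G * v) v (swap S) ¬A₀ | cannot-join-witness (G * v) v (swap S) ¬A₁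
  ... | y₁ , y₁∈B , v≁y₁ | y₂ , y₂∈B , Ny₂≢B' | x₁ , x₁∈A , v≁x₁ | x₂ , x₂∈A , Nx₂≢A' =
    five-cycle (not-injective x₁∈A) (not-injective x₂∈A) y₁∈B y₂∈B
      (¬-not (v≁x₁ ∘ centre x₁)) (¬-not (v≁y₁ ∘ centre y₁))
      (Nx₂≢A' ∘ centre x₂) (Ny₂≢B' ∘ centre y₂)
    where
    centre : ∀ y {b} → N y ≡ b → adj (G * v) v (punchIn v y) ≡ b
    centre y = trans (*-adj-centre G v (punchIn v y))

lemma7p1 : ∀ {m : ℕ} (G : Graph (suc m)) → Bipartite G → Prime G →
    ∀ (v : Fin (suc m)) → Prime ((G * v) ∖ v)
lemma7p1 G bip prime v S =
  v-joins-a-side G v bip S (absurd-join S) (absurd-join S) (absurd-join (swap S)) (absurd-join (swap S))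
  where
  absurd-join : ∀ T {c} → ¬ CanJoinA (G * v) v T c
  absurd-join T = prime ∘ *-reflects-Split {v = v} ∘ join-A (G * v) v T
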